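{- Let $T$ be a string of length $n$ and $1 < i \le j \le n$. For any $i \le s \le t \le j$: $[s,t] \notin \mathsf{MUS}(T[i-1..j])$ and $[s,t] \in \mathsf{MUS}(T[i..j])$ if and only if $T[s..t] = \mathit{sqp}_{i-1,j}$ and $\#\mathit{occ}_{T[i-1..j]}(\mathit{sqp}_{i-1,j}) = 2$.
   Context: For a string $W$, $W[a..b]$ is the substring from position $a$ to position $b$ (empty if $a>b$). For strings $w,W$, $\#\mathit{occ}_W(w)$ is the number of positions at which $w$ occurs in $W$, with $\#\mathit{occ}_W(\varepsilon)=|W|+1$. A substring $w$ of $W$ is unique in $W$ if $\#\mathit{occ}_W(w)=1$, repeating if $\#\mathit{occ}_W(w)\ge 2$, quasi-unique if $1\le\#\mathit{occ}_W(w)\le 2$. For $1\le a\le b\le n$, $\mathsf{MUS}(T[a..b])$ is the set of intervals $[s,t]$ with $a\le s\le t\le b$ (positions refer to $T$) such that $T[s..t]$ is unique in $T[a..b]$ and both $T[s+1..t]$ and $T[s..t-1]$ are repeating in $T[a..b]$. $\mathit{sqp}_{a,b}$ is the shortest non-empty prefix of $T[a..b]$ that is quasi-unique in $T[a..b]$. -}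

module Defs where

open import Data.Nat using (ℕ; zero; suc; _∸_; _≤_; _≤ᵇ_; _+_)
open import Data.Bool using (Bool; true; false; _∧_; if_then_else_)
open import Data.List using (List; []; _∷_; length; take; drop; upTo; map)
open import Data.Nat.ListAction using (sum)
open import Relation.Nullary.Decidable using (does)
open import Relation.Binary.Definitions using (DecidableEquality)
open import Relation.Binary.PropositionalEquality using (_≡_)
open import Data.Product using (_×_)

-- Strings are lists over an alphabet A with decidable equality.
-- Positions are 1-based, as in the paper.

module _ {A : Set} (_≟_ : DecidableEquality A) where

  isPrefix : List A → List A → Bool
  isPrefix []       _        = true
  isPrefix (_ ∷ _)  []       = false
  isPrefix (x ∷ xs) (y ∷ ys) = does (x ≟ y) ∧ isPrefix xs ys

  -- #occ_W(w): number of positions p ∈ {0,…,|W|} (0-based) such that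
  -- w occurs in W starting at p.  For w = ε this is |W|+1.
  occ : List A → List A → ℕ
  occ w W = sum (map (λ p → if isPrefix w (drop p W) then 1 else 0) (upTo (suc (length W))))

  Unique : List A → List A → Set
  Unique w W = occ w W ≡ 1

  Repeating : List A → List A → Set
  Repeating w W = 2 ≤ occ w W

  quasiUniqueᵇ : List A → List A → Bool
  quasiUniqueᵇ w W = (1 ≤ᵇ occ w W) ∧ (occ w W ≤ᵇ 2)

  -- sqp of W: the shortest non-empty prefix of W that is quasi-unique in W.
  -- Search lengths k = 1, 2, …, |W|; (default W, never reached for non-empty W,
  -- since W itself is unique in W).
  sqpFrom : List A → ℕ → ℕ → List A
  sqpFrom W k zero    = W
  sqpFrom W k (suc f) =
    if quasiUniqueᵇ (take k W) W then take k W else sqpFrom W (suc k) f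

  sqpOf : List A → List A
  sqpOf W = sqpFrom W 1 (length W)

  -- T[a..b] (1-based, inclusive; empty if a > b)
  sub : List A → ℕ → ℕ → List A
  sub T a b = take (suc b ∸ a) (drop (a ∸ 1) T)

  InMUS : List A → ℕ → ℕ → ℕ → ℕ → Set
  InMUS T a b s t =
    (a ≤ s) × (s ≤ t) × (t ≤ b) ×
    Unique (sub T s t) (sub T a b) ×
    Repeating (sub T (suc s) t) (sub T a b) ×
    Repeating (sub T s (t ∸ 1)) (sub T a b)

  sqp : List A → ℕ → ℕ → List A
  sqp T a b = sqpOf (sub T a b)

{-# OPTIONS --safe #-}
-- Let W′ = c ∷ W be T[i-1..j] and W = T[i..j].  A word occurs in W′ once more than in W if it
-- is a prefix of W′, and equally often otherwise.  Hence a MUS u of W fails to be a MUS of W′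
-- only if u is a prefix of W′ occurring twice in it; then u without its last letter occurs at
-- least three times in W′, and so do all shorter prefixes, so u is the shortest quasi-unique
-- prefix sqp(W′).  Conversely, if sqp(W′) occurs twice in W′ it is unique in W; by minimality
-- its prefix one letter shorter occurs three times in W′, hence twice in W, and its suffix one
-- letter shorter is a prefix of W occurring again right after the occurrence of sqp(W′) in W.
module Submission where

open import Defs
open import Data.Nat using (ℕ; zero; suc; pred; _+_; _∸_; _⊓_; _≤_; _<_; _≤ᵇ_; z≤n; s≤s) renaming (_≟_ to _≟ℕ_)
open import Data.Nat.Properties
open import Data.Nat.ListAction using (sum)
open import Data.Bool using (Bool; true; false; _∧_; if_then_else_)
open import Data.Bool.Properties using (¬-not)
open import Data.List using (List; []; _∷_; length; take; drop; map; upTo)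
open import Data.List.Properties using (map-applyUpTo; take-take; take-all; take-[]; length-take; length-drop; drop-drop)
open import Data.Empty using (⊥-elim)
open import Data.Product using (Σ; _×_; _,_)
open import Data.Product.Function.NonDependent.Propositional using (_×-⇔_)
open import Relation.Nullary using (¬_; yes; no; does; contradiction)
open import Relation.Nullary.Decidable using (dec-true)
open import Relation.Binary.Definitions using (DecidableEquality)
open import Relation.Binary.PropositionalEquality using (_≡_; refl; sym; trans; cong; cong₂; subst; module ≡-Reasoning)
open import Function.Bundles using (_⇔_; mk⇔)
open import Function.Construct.Composition using (_⇔-∘_)
open import Function.Related.TypeIsomorphisms using (¬-cong-⇔)

[_] : Bool → ℕ
[ b ] = if b then 1 else 0

[∧]≤[] : ∀ b c → [ b ∧ c ] ≤ [ c ]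
[∧]≤[] true  c = ≤-refl
[∧]≤[] false c = z≤n

sum-upTo-suc : ∀ (f : ℕ → ℕ) n → sum (map f (upTo (suc n))) ≡ f 0 + sum (map (λ p → f (suc p)) (upTo n))
sum-upTo-suc f n = cong (λ l → f 0 + sum l)
  (trans (map-applyUpTo suc f n) (sym (map-applyUpTo (λ p → p) (λ p → f (suc p)) n)))

take-take-≤ : ∀ {A : Set} {m n} (Z : List A) → m ≤ n → take m (take n Z) ≡ take m Z
take-take-≤ {m = m} {n} Z m≤n = trans (take-take m n Z) (cong (λ k → take k Z) (m≤n⇒m⊓n≡m m≤n))

module _ {A : Set} (_≟_ : DecidableEquality A) where

  isPrefix-trans : ∀ u v (Z : List A) → isPrefix _≟_ u v ≡ true → isPrefix _≟_ v Z ≡ true → isPrefix _≟_ u Z ≡ true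
  isPrefix-trans []      v       Z       _  _  = refl
  isPrefix-trans (x ∷ u) (y ∷ v) (z ∷ Z) uv vZ with x ≟ y | y ≟ z
  ... | yes refl | yes refl rewrite dec-true (x ≟ x) refl = isPrefix-trans u v Z uv vZ

  isPrefix-take : ∀ n (Z : List A) → isPrefix _≟_ (take n Z) Z ≡ true
  isPrefix-take zero    Z       = refl
  isPrefix-take (suc n) []      = refl
  isPrefix-take (suc n) (z ∷ Z) rewrite dec-true (z ≟ z) refl = isPrefix-take n Z

  isPrefix-take-mono : ∀ {m n} (Z : List A) → m ≤ n → isPrefix _≟_ (take m Z) (take n Z) ≡ true
  isPrefix-take-mono {m} {n} Z m≤n =
    subst (λ v → isPrefix _≟_ v (take n Z) ≡ true) (take-take-≤ Z m≤n) (isPrefix-take m (take n Z))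

  isPrefix⇒≡take : ∀ (v Z : List A) → isPrefix _≟_ v Z ≡ true → v ≡ take (length v) Z
  isPrefix⇒≡take []      Z       _  = refl
  isPrefix⇒≡take (x ∷ v) (z ∷ Z) vZ with x ≟ z
  ... | yes refl = cong (x ∷_) (isPrefix⇒≡take v Z vZ)

  occ-∷ : ∀ w c (W : List A) → occ _≟_ w (c ∷ W) ≡ [ isPrefix _≟_ w (c ∷ W) ] + occ _≟_ w W
  occ-∷ w c W = sum-upTo-suc (λ p → [ isPrefix _≟_ w (drop p (c ∷ W)) ]) (suc (length W))

  occ-∷-prefix : ∀ w c (W : List A) → isPrefix _≟_ w (c ∷ W) ≡ true → occ _≟_ w (c ∷ W) ≡ suc (occ _≟_ w W)
  occ-∷-prefix w c W prefix = trans (occ-∷ w c W) (cong (λ b → [ b ] + occ _≟_ w W) prefix)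

  occ-∷-¬prefix : ∀ w c (W : List A) → isPrefix _≟_ w (c ∷ W) ≡ false → occ _≟_ w (c ∷ W) ≡ occ _≟_ w W
  occ-∷-¬prefix w c W ¬prefix = trans (occ-∷ w c W) (cong (λ b → [ b ] + occ _≟_ w W) ¬prefix)

  occ-≤-∷ : ∀ w c (W : List A) → occ _≟_ w W ≤ occ _≟_ w (c ∷ W)
  occ-≤-∷ w c W rewrite occ-∷ w c W = m≤n+m (occ _≟_ w W) [ isPrefix _≟_ w (c ∷ W) ]

  occ-∷-∷-≤ : ∀ x w y (W : List A) → occ _≟_ (x ∷ w) (y ∷ W) ≤ occ _≟_ w W
  occ-∷-∷-≤ x w y [] = +-monoˡ-≤ 0 ([∧]≤[] (does (x ≟ y)) (isPrefix _≟_ w []))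
  occ-∷-∷-≤ x w y (z ∷ W) rewrite occ-∷ (x ∷ w) y (z ∷ W) | occ-∷ w z W =
    +-mono-≤ ([∧]≤[] (does (x ≟ y)) (isPrefix _≟_ w (z ∷ W))) (occ-∷-∷-≤ x w z W)

  isPrefix-count-mono : ∀ v w → isPrefix _≟_ v w ≡ true → ∀ Z → [ isPrefix _≟_ w Z ] ≤ [ isPrefix _≟_ v Z ]
  isPrefix-count-mono v w vw Z with isPrefix _≟_ w Z in wZ
  ... | false = z≤n
  ... | true rewrite isPrefix-trans v w Z vw wZ = ≤-refl

  occ-prefix-mono : ∀ v w → isPrefix _≟_ v w ≡ true → ∀ W → occ _≟_ w W ≤ occ _≟_ v W
  occ-prefix-mono v w vw []      = +-monoˡ-≤ 0 (isPrefix-count-mono v w vw [])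
  occ-prefix-mono v w vw (c ∷ W) rewrite occ-∷ w c W | occ-∷ v c W =
    +-mono-≤ (isPrefix-count-mono v w vw (c ∷ W)) (occ-prefix-mono v w vw W)

  occ≡2⇒quasiUnique : ∀ w W → occ _≟_ w W ≡ 2 → quasiUniqueᵇ _≟_ w W ≡ true
  occ≡2⇒quasiUnique w W twice rewrite twice = refl

  3≤occ⇒¬quasiUnique : ∀ w W → 3 ≤ occ _≟_ w W → quasiUniqueᵇ _≟_ w W ≡ false
  3≤occ⇒¬quasiUnique w W = go (occ _≟_ w W)
    where
    go : ∀ o → 3 ≤ o → (1 ≤ᵇ o) ∧ (o ≤ᵇ 2) ≡ false
    go 1                   (s≤s ())
    go 2                   (s≤s (s≤s ()))
    go (suc (suc (suc _))) _ = refl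

  ¬quasiUnique⇒3≤occ : ∀ w W → 1 ≤ occ _≟_ w W → quasiUniqueᵇ _≟_ w W ≡ false → 3 ≤ occ _≟_ w W
  ¬quasiUnique⇒3≤occ w W = go (occ _≟_ w W)
    where
    go : ∀ o → 1 ≤ o → (1 ≤ᵇ o) ∧ (o ≤ᵇ 2) ≡ false → 3 ≤ o
    go 1                   _ ()
    go 2                   _ ()
    go (suc (suc (suc _))) _ _ = s≤s (s≤s (s≤s z≤n))

  sqpFrom-isPrefix : ∀ W k f → isPrefix _≟_ (sqpFrom _≟_ W k f) W ≡ true
  sqpFrom-isPrefix W k zero = subst (λ v → isPrefix _≟_ v W ≡ true) (take-all (length W) W ≤-refl) (isPrefix-take (length W) W)
  sqpFrom-isPrefix W k (suc f) with quasiUniqueᵇ _≟_ (take k W) W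
  ... | true  = isPrefix-take k W
  ... | false = sqpFrom-isPrefix W (suc k) f

  sqpFrom-least : ∀ W k f m → k ≤ m → length W ≤ k + f →
                  (∀ k′ → k ≤ k′ → k′ < m → quasiUniqueᵇ _≟_ (take k′ W) W ≡ false) →
                  quasiUniqueᵇ _≟_ (take m W) W ≡ true → sqpFrom _≟_ W k f ≡ take m W
  sqpFrom-least W k zero    m k≤m |W|≤k+0 _ _ =
    sym (take-all m W (≤-trans |W|≤k+0 (≤-trans (≤-reflexive (+-identityʳ k)) k≤m)))
  sqpFrom-least W k (suc f) m k≤m |W|≤k+f shorter hit with k ≟ℕ m
  ... | yes refl rewrite hit = refl
  ... | no k≢m rewrite shorter k ≤-refl (≤∧≢⇒< k≤m k≢m) =
    sqpFrom-least W (suc k) f m (≤∧≢⇒< k≤m k≢m) (≤-trans |W|≤k+f (≤-reflexive (+-suc k f)))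
                  (λ k′ k<k′ → shorter k′ (<⇒≤ k<k′)) hit

  sqpFrom-minimal : ∀ W k f k′ → length W ≤ k + f → k ≤ k′ → k′ < length (sqpFrom _≟_ W k f) →
                    quasiUniqueᵇ _≟_ (take k′ W) W ≡ false
  sqpFrom-minimal W k zero    k′ |W|≤k+0 k≤k′ k′<|W| =
    ⊥-elim (≤⇒≯ k≤k′ (<-≤-trans k′<|W| (≤-trans |W|≤k+0 (≤-reflexive (+-identityʳ k)))))
  sqpFrom-minimal W k (suc f) k′ |W|≤k+f k≤k′ k′<|sqp| with quasiUniqueᵇ _≟_ (take k W) W in quasi
  ... | true  = ⊥-elim (≤⇒≯ k≤k′ (<-≤-trans k′<|sqp| (≤-trans (≤-reflexive (length-take k W)) (m⊓n≤m k (length W)))))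
  ... | false with k ≟ℕ k′
  ...   | yes refl = quasi
  ...   | no k≢k′  = sqpFrom-minimal W (suc k) f k′ (≤-trans |W|≤k+f (≤-reflexive (+-suc k f))) (≤∧≢⇒< k≤k′ k≢k′) k′<|sqp|

  -- Used for u of length suc d, so that take d u is u without its last letter.
  MinUnique : List A → List A → ℕ → Set
  MinUnique W u d = Unique _≟_ u W × Repeating _≟_ (drop 1 u) W × Repeating _≟_ (take d u) W

  Repeating-∷ : ∀ w c W → Repeating _≟_ w W → Repeating _≟_ w (c ∷ W)
  Repeating-∷ w c W rep = ≤-trans rep (occ-≤-∷ w c W)

  -- W[0..d) occurs at 0 and right after the unique occurrence of c W[0..d).
  Unique-∷-take⇒Repeating-take : ∀ c (W : List A) d → Unique _≟_ (c ∷ take d W) W → Repeating _≟_ (take d W) W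
  Unique-∷-take⇒Repeating-take c []      d ()
  Unique-∷-take⇒Repeating-take c (y ∷ W) d once
    rewrite occ-∷-prefix (take d (y ∷ W)) y W (isPrefix-take d (y ∷ W)) =
    s≤s (≤-trans (≤-reflexive (sym once)) (occ-∷-∷-≤ c (take d (y ∷ W)) y W))

  MinUnique-∷ : ∀ c W u d → isPrefix _≟_ u (c ∷ W) ≡ false → MinUnique W u d → MinUnique (c ∷ W) u d
  MinUnique-∷ c W u d ¬prefix (once , rep₁ , rep₂) =
    trans (occ-∷-¬prefix u c W ¬prefix) once , Repeating-∷ (drop 1 u) c W rep₁ , Repeating-∷ (take d u) c W rep₂

  sqpOf-∷-of-MinUnique : ∀ c W u d → length u ≡ suc d → ¬ MinUnique (c ∷ W) u d → MinUnique W u d →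
                         (u ≡ sqpOf _≟_ (c ∷ W)) × (occ _≟_ (sqpOf _≟_ (c ∷ W)) (c ∷ W) ≡ 2)
  sqpOf-∷-of-MinUnique c W u d |u| ¬minUnique′ minUnique@(once , _ , rep₂) =
    u≡sqp , subst (λ v → occ _≟_ v (c ∷ W) ≡ 2) u≡sqp twice
    where
    prefix : isPrefix _≟_ u (c ∷ W) ≡ true
    prefix = ¬-not (λ ¬prefix → ¬minUnique′ (MinUnique-∷ c W u d ¬prefix minUnique))
    twice : occ _≟_ u (c ∷ W) ≡ 2
    twice = trans (occ-∷-prefix u c W prefix) (cong suc once)
    u≡take : u ≡ take (suc d) (c ∷ W)
    u≡take = trans (isPrefix⇒≡take u (c ∷ W) prefix) (cong (λ k → take k (c ∷ W)) |u|)
    init≡take : take d u ≡ take d (c ∷ W)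
    init≡take = trans (cong (take d) u≡take) (take-take-≤ (c ∷ W) (n≤1+n d))
    init-thrice : 3 ≤ occ _≟_ (take d (c ∷ W)) (c ∷ W)
    init-thrice rewrite occ-∷-prefix (take d (c ∷ W)) c W (isPrefix-take d (c ∷ W)) =
      s≤s (subst (λ v → 2 ≤ occ _≟_ v W) init≡take rep₂)
    shorter : ∀ k → 1 ≤ k → k < suc d → quasiUniqueᵇ _≟_ (take k (c ∷ W)) (c ∷ W) ≡ false
    shorter k _ (s≤s k≤d) = 3≤occ⇒¬quasiUnique (take k (c ∷ W)) (c ∷ W)
      (≤-trans init-thrice (occ-prefix-mono (take k (c ∷ W)) (take d (c ∷ W)) (isPrefix-take-mono (c ∷ W) k≤d) (c ∷ W)))
    u≡sqp : u ≡ sqpOf _≟_ (c ∷ W)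
    u≡sqp = trans u≡take (sym (sqpFrom-least (c ∷ W) 1 (length (c ∷ W)) (suc d) (s≤s z≤n) (n≤1+n _) shorter
              (occ≡2⇒quasiUnique (take (suc d) (c ∷ W)) (c ∷ W) (subst (λ v → occ _≟_ v (c ∷ W) ≡ 2) u≡take twice))))

  sqpOf≡take : ∀ W d → length (sqpOf _≟_ W) ≡ suc d → sqpOf _≟_ W ≡ take (suc d) W
  sqpOf≡take W d |v| = trans (isPrefix⇒≡take (sqpOf _≟_ W) W (sqpFrom-isPrefix W 1 (length W))) (cong (λ k → take k W) |v|)

  sqpOf-∷-Unique : ∀ c W → occ _≟_ (sqpOf _≟_ (c ∷ W)) (c ∷ W) ≡ 2 → Unique _≟_ (sqpOf _≟_ (c ∷ W)) W
  sqpOf-∷-Unique c W twice =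
    suc-injective (trans (sym (occ-∷-prefix (sqpOf _≟_ (c ∷ W)) c W (sqpFrom-isPrefix (c ∷ W) 1 (length (c ∷ W))))) twice)

  sqpOf-∷-tail-Repeating : ∀ c W d → length (sqpOf _≟_ (c ∷ W)) ≡ suc d → occ _≟_ (sqpOf _≟_ (c ∷ W)) (c ∷ W) ≡ 2 →
                           Repeating _≟_ (take d W) W
  sqpOf-∷-tail-Repeating c W d |v| twice = Unique-∷-take⇒Repeating-take c W d
    (subst (λ v → Unique _≟_ v W) (sqpOf≡take (c ∷ W) d |v|) (sqpOf-∷-Unique c W twice))

  sqpOf-∷-init-Repeating : ∀ c W d → length (sqpOf _≟_ (c ∷ W)) ≡ suc d → occ _≟_ (sqpOf _≟_ (c ∷ W)) (c ∷ W) ≡ 2 →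
                           Repeating _≟_ (take d (c ∷ W)) W
  sqpOf-∷-init-Repeating c W zero    |v| twice = sqpOf-∷-tail-Repeating c W zero |v| twice
  sqpOf-∷-init-Repeating c W (suc d) |v| twice =
    ≤-pred (subst (3 ≤_) (occ-∷-prefix init c W (isPrefix-take (suc d) (c ∷ W))) thrice)
    where
    init : List A
    init = take (suc d) (c ∷ W)
    init-prefix : isPrefix _≟_ init (sqpOf _≟_ (c ∷ W)) ≡ true
    init-prefix = subst (λ v → isPrefix _≟_ init v ≡ true) (sym (sqpOf≡take (c ∷ W) (suc d) |v|)) (isPrefix-take-mono (c ∷ W) (n≤1+n (suc d)))
    twice-at-least : 2 ≤ occ _≟_ init (c ∷ W)
    twice-at-least = ≤-trans (≤-reflexive (sym twice)) (occ-prefix-mono init (sqpOf _≟_ (c ∷ W)) init-prefix (c ∷ W))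
    thrice : 3 ≤ occ _≟_ init (c ∷ W)
    thrice = ¬quasiUnique⇒3≤occ init (c ∷ W) (≤-trans (s≤s z≤n) twice-at-least)
               (sqpFrom-minimal (c ∷ W) 1 (length (c ∷ W)) (suc d) (n≤1+n _) (s≤s z≤n) (≤-reflexive (sym |v|)))

  MinUnique-of-sqpOf-∷ : ∀ c W d → length (sqpOf _≟_ (c ∷ W)) ≡ suc d → occ _≟_ (sqpOf _≟_ (c ∷ W)) (c ∷ W) ≡ 2 →
                         ¬ MinUnique (c ∷ W) (sqpOf _≟_ (c ∷ W)) d × MinUnique W (sqpOf _≟_ (c ∷ W)) d
  MinUnique-of-sqpOf-∷ c W d |v| twice =
    (λ (once′ , _) → contradiction (trans (sym once′) twice) λ ()) ,
    sqpOf-∷-Unique c W twice ,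
    subst (λ v → Repeating _≟_ (drop 1 v) W) (sym v≡take) (sqpOf-∷-tail-Repeating c W d |v| twice) ,
    subst (λ v → Repeating _≟_ (take d v) W) (sym v≡take)
      (subst (λ v → Repeating _≟_ v W) (sym (take-take-≤ (c ∷ W) (n≤1+n d))) (sqpOf-∷-init-Repeating c W d |v| twice))
    where
    v≡take : sqpOf _≟_ (c ∷ W) ≡ take (suc d) (c ∷ W)
    v≡take = sqpOf≡take (c ∷ W) d |v|

  MinUnique-tail⇔sqpOf : ∀ c W u d → length u ≡ suc d →
                         ((¬ MinUnique (c ∷ W) u d) × MinUnique W u d)
                           ⇔ ((u ≡ sqpOf _≟_ (c ∷ W)) × (occ _≟_ (sqpOf _≟_ (c ∷ W)) (c ∷ W) ≡ 2))
  MinUnique-tail⇔sqpOf c W u d |u| = mk⇔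
    (λ (¬minUnique′ , minUnique) → sqpOf-∷-of-MinUnique c W u d |u| ¬minUnique′ minUnique)
    (λ { (refl , twice) → MinUnique-of-sqpOf-∷ c W d |u| twice })

  drop-∷ : ∀ a (T : List A) → a < length T → Σ A λ c → drop a T ≡ c ∷ drop (suc a) T
  drop-∷ zero    (c ∷ T) _         = c , refl
  drop-∷ (suc a) (_ ∷ T) (s≤s a<T) = drop-∷ a T a<T

  drop-1-take : ∀ n (X : List A) → drop 1 (take n X) ≡ take (pred n) (drop 1 X)
  drop-1-take zero    X       = refl
  drop-1-take (suc n) []      = sym (take-[] n)
  drop-1-take (suc n) (x ∷ X) = refl

  sub-∷ : ∀ T a b → 1 ≤ a → a ≤ b → b ≤ length T → Σ A λ c → sub _≟_ T a b ≡ c ∷ sub _≟_ T (suc a) b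
  sub-∷ T (suc a) b _ a<b b≤T with drop-∷ a T (<-≤-trans a<b b≤T)
  ... | c , drop≡ = c , cong₂ take (+-∸-assoc 1 a<b) drop≡

  sub-suc-start : ∀ T s t → 1 ≤ s → sub _≟_ T (suc s) t ≡ drop 1 (sub _≟_ T s t)
  sub-suc-start T (suc s) t _ = sym (trans (drop-1-take (t ∸ s) (drop s T))
    (cong₂ take (pred[m∸n]≡m∸[1+n] t s) (trans (drop-drop s 1 T) (cong (λ k → drop k T) (+-comm s 1)))))

  sub-pred-end : ∀ T s t → 1 ≤ t → sub _≟_ T s (t ∸ 1) ≡ take (t ∸ s) (sub _≟_ T s t)
  sub-pred-end T s (suc t) _ = sym (take-take-≤ (drop (s ∸ 1) T) (∸-monoˡ-≤ s (n≤1+n (suc t))))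

  length-sub : ∀ T s t → 1 ≤ s → s ≤ t → t ≤ length T → length (sub _≟_ T s t) ≡ suc (t ∸ s)
  length-sub T (suc s) t _ s<t t≤T = begin
    length (take (t ∸ s) (drop s T))  ≡⟨ length-take (t ∸ s) (drop s T) ⟩
    (t ∸ s) ⊓ length (drop s T)       ≡⟨ cong ((t ∸ s) ⊓_) (length-drop s T) ⟩
    (t ∸ s) ⊓ (length T ∸ s)          ≡⟨ m≤n⇒m⊓n≡m (∸-monoˡ-≤ s t≤T) ⟩
    t ∸ s                             ≡⟨ +-∸-assoc 1 s<t ⟩
    suc (t ∸ suc s)                   ∎
    where open ≡-Reasoning

  InMUS⇔MinUnique : ∀ T a b s t → 1 ≤ s → a ≤ s → s ≤ t → t ≤ b →
                    InMUS _≟_ T a b s t ⇔ MinUnique (sub _≟_ T a b) (sub _≟_ T s t) (t ∸ s)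
  InMUS⇔MinUnique T a b s t 1≤s a≤s s≤t t≤b = mk⇔
    (λ (_ , _ , _ , once , rep₁ , rep₂) →
       once , subst (λ v → Repeating _≟_ v W) start≡ rep₁ , subst (λ v → Repeating _≟_ v W) end≡ rep₂)
    (λ (once , rep₁ , rep₂) →
       a≤s , s≤t , t≤b , once , subst (λ v → Repeating _≟_ v W) (sym start≡) rep₁
                              , subst (λ v → Repeating _≟_ v W) (sym end≡) rep₂)
    where
    W : List A
    W = sub _≟_ T a b
    start≡ : sub _≟_ T (suc s) t ≡ drop 1 (sub _≟_ T s t)
    start≡ = sub-suc-start T s t 1≤s
    end≡ : sub _≟_ T s (t ∸ 1) ≡ take (t ∸ s) (sub _≟_ T s t)
    end≡ = sub-pred-end T s t (≤-trans 1≤s s≤t)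

lemma17 : {A : Set} (_≟_ : DecidableEquality A) (T : List A) (i j s t : ℕ) →
          1 < i → i ≤ j → j ≤ length T →
          i ≤ s → s ≤ t → t ≤ j →
          ((¬ InMUS _≟_ T (i ∸ 1) j s t) × InMUS _≟_ T i j s t)
            ⇔ ((sub _≟_ T s t ≡ sqp _≟_ T (i ∸ 1) j)
               × (occ _≟_ (sqp _≟_ T (i ∸ 1) j) (sub _≟_ T (i ∸ 1) j) ≡ 2))
lemma17 {A} _≟_ T (suc i) j s t (s≤s 1≤i) i<j j≤T i<s s≤t t≤j with sub-∷ _≟_ T i j 1≤i (<⇒≤ i<j) j≤T
... | c , split =
  subst (λ W′ → ((¬ MinUnique _≟_ W′ u d) × MinUnique _≟_ W u d)
                  ⇔ ((u ≡ sqpOf _≟_ W′) × (occ _≟_ (sqpOf _≟_ W′) W′ ≡ 2)))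
        (sym split) (MinUnique-tail⇔sqpOf _≟_ c W u d (length-sub _≟_ T s t 1≤s s≤t (≤-trans t≤j j≤T)))
  ⇔-∘ (¬-cong-⇔ (InMUS⇔MinUnique _≟_ T i j s t 1≤s (<⇒≤ i<s) s≤t t≤j)
       ×-⇔ InMUS⇔MinUnique _≟_ T (suc i) j s t 1≤s i<s s≤t t≤j)
  where
  W u : List A
  W = sub _≟_ T (suc i) j
  u = sub _≟_ T s t
  d : ℕ
  d = t ∸ s
  1≤s : 1 ≤ s
  1≤s = ≤-trans (s≤s z≤n) i<s
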